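{- Let $\{\overrightarrow{AB},\overrightarrow{CD}\}$ be a proper pair of collinear segments that define a $2$-threshold function $f$ on $\mathcal{G}_{m,n}$. Then $M_1(f)=AC\cap\mathcal{G}_{m,n}$.
   Context: $\mathcal{G}_{m,n}=\{0,\dots,m-1\}\times\{0,\dots,n-1\}$; $M_1(f)$ is the set of true points of $f$. A $2$-threshold function is a conjunction of at most two threshold functions ($f$ threshold iff $f(x_1,x_2)=1\iff a_1x_1+a_2x_2\ge a_0$ for some $a_0,a_1,a_2$). Two integer points are adjacent if the segment joining them contains no other integer point; such a segment is called prime. For distinct points $A,B,C$ the oriented triangle $\overrightarrow{ABC}$ is counterclockwise if the determinant with rows $(a_1,a_2,1),(b_1,b_2,1),(c_1,c_2,1)$ is positive. For adjacent $A,B\in\mathcal{G}_{m,n}$, $f_{\overrightarrow{AB}}:\mathcal{G}_{m,n}\to\{0,1\}$ has $f(A)=1$, $f(B)=0$; for $X$ on the line $\ell(AB)$, $f(X)=1$ iff $d(A,X)<d(B,X)$; for $X\notin\ell(AB)$, $f(X)=1$ iff $\overrightarrow{ABX}$ is counterclockwise. A pair $\{\overrightarrow{AB},\overrightarrow{CD}\}$ defines $f$ if $f=f_{\overrightarrow{AB}}\wedge f_{\overrightarrow{CD}}$; it is proper if both segments are prime and $f_{\overrightarrow{CD}}(A)=f_{\overrightarrow{CD}}(B)=f_{\overrightarrow{AB}}(C)=f_{\overrightarrow{AB}}(D)=1$. -}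

module Defs where

open import Data.Nat using (ℕ)
open import Data.Integer using (ℤ; +_; _+_; _-_; _*_; _≤_; _<_; _⊓_; _⊔_; _≟_; _<?_; 0ℤ)
open import Data.Bool using (Bool; true; false; if_then_else_; _∧_)
open import Data.Product using (_×_; _,_; proj₁; proj₂)
open import Data.Sum using (_⊎_)
open import Relation.Binary.PropositionalEquality using (_≡_)
open import Relation.Nullary using (¬_)
open import Relation.Nullary.Decidable using (⌊_⌋)

Point : Set
Point = ℤ × ℤ

InGrid : ℕ → ℕ → Point → Set
InGrid m n (x , y) = (0ℤ ≤ x × x < + m) × (0ℤ ≤ y × y < + n)

-- Determinant with rows (a1,a2,1),(b1,b2,1),(c1,c2,1) (cofactor expansion).
det : Point → Point → Point → ℤ
det (a1 , a2) (b1 , b2) (c1 , c2) =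
  ((a1 * b2 + a2 * c1) + b1 * c2) - ((c1 * b2 + c2 * a1) + b1 * a2)

-- Squared Euclidean distance (d(P,X) < d(Q,X) iff squared distances compare so).
dist² : Point → Point → ℤ
dist² (a1 , a2) (b1 , b2) = (a1 - b1) * (a1 - b1) + (a2 - b2) * (a2 - b2)

OnSegment : Point → Point → Point → Set
OnSegment P Q X =
  det P Q X ≡ 0ℤ
  × ((proj₁ P ⊓ proj₁ Q ≤ proj₁ X × proj₁ X ≤ proj₁ P ⊔ proj₁ Q)
  × (proj₂ P ⊓ proj₂ Q ≤ proj₂ X × proj₂ X ≤ proj₂ P ⊔ proj₂ Q))

Adjacent : Point → Point → Set
Adjacent A B = ¬ (A ≡ B) × (∀ (X : Point) → OnSegment A B X → (X ≡ A) ⊎ (X ≡ B))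

fDir : Point → Point → Point → Bool
fDir A B X =
  if ⌊ det A B X ≟ 0ℤ ⌋
  then ⌊ dist² A X <? dist² B X ⌋
  else ⌊ 0ℤ <? det A B X ⌋

Defines : ℕ → ℕ → Point → Point → Point → Point → (Point → Bool) → Set
Defines m n A B C D f = ∀ (X : Point) → InGrid m n X → f X ≡ (fDir A B X ∧ fDir C D X)

Proper : ℕ → ℕ → Point → Point → Point → Point → Set
Proper m n A B C D =
  (InGrid m n A × InGrid m n B × InGrid m n C × InGrid m n D)
  × (Adjacent A B × Adjacent C D)
  × ((fDir C D A ≡ true × fDir C D B ≡ true)
  × (fDir A B C ≡ true × fDir A B D ≡ true))

CollinearSegs : Point → Point → Point → Point → Set
CollinearSegs A B C D = det A B C ≡ 0ℤ × det A B D ≡ 0ℤ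

-- Put u = B - A. As AB is prime, the integer points of ℓ(AB) are exactly P k = A + k u, and
-- f_AB(P k) = 1 iff k ≤ 0. Thus C = P c and D = P d with c, d ≤ 0; as CD is prime, d = c ± 1,
-- and f_CD(A) = 1 excludes d = c + 1. On ℓ(AB) the pair then cuts out c ≤ k ≤ 0, i.e. the
-- segment AC. Off the line det(C, D, X) = -det(A, B, X), so the two open half-planes are
-- opposite and contain no common point.

module Submission where

open import Defs
open import Data.Bool using (Bool; true; false; _∧_)
open import Data.Integer
  using (ℤ; +_; -[1+_]; _+_; _-_; _*_; -_; _≤_; _<_; _⊓_; _⊔_; _≟_; _<?_; 0ℤ; 1ℤ; -1ℤ; suc; pred
        ; +≤+; +<+; +[1+_]; NonZero; ≢-nonZero; >-nonZero; positive; nonNegative; nonPositive; negative)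
open import Data.Integer.Properties
open import Data.Integer.DivMod using (_/_; _%_; a≡a%n+[a/n]*n; n%d<d)
open import Data.Integer.Tactic.RingSolver using (solve-∀)
open import Algebra.Properties.AbelianGroup +-0-abelianGroup using () renaming (∙-cancelˡ to +-cancelˡ-≡)
open import Data.Nat using (ℕ; z≤n; z<s)
open import Data.Product using (∃-syntax; _×_; _,_; proj₁; proj₂; swap)
open import Data.Product.Function.NonDependent.Propositional using (_×-⇔_)
open import Data.Sum using (_⊎_; inj₁; inj₂; [_,_]′)
open import Function.Base using (id; _∘_)
open import Function.Bundles using (_⇔_; mk⇔; Equivalence)
open import Function.Construct.Symmetry using (⇔-sym)
open import Function.Related.Propositional using (module EquationalReasoning)
open import Relation.Binary.Definitions using (Tri; tri<; tri≈; tri>)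
open import Relation.Binary.PropositionalEquality
open import Relation.Nullary using (Dec; yes; no; contradiction)
open import Relation.Nullary.Decidable using (⌊_⌋)

⌊⌋≡true⇔ : ∀ {p} {P : Set p} (p? : Dec P) → (⌊ p? ⌋ ≡ true) ⇔ P
⌊⌋≡true⇔ (yes p) = mk⇔ (λ _ → p) (λ _ → refl)
⌊⌋≡true⇔ (no ¬p) = mk⇔ (λ ()) (λ p → contradiction p ¬p)

∧≡true⇔ : ∀ {x y} → (x ∧ y ≡ true) ⇔ (x ≡ true × y ≡ true)
∧≡true⇔ {true}  = mk⇔ (refl ,_) proj₂
∧≡true⇔ {false} = mk⇔ (λ ()) (λ ())

fDir≡true-on-line : ∀ A B X → det A B X ≡ 0ℤ → (fDir A B X ≡ true) ⇔ (dist² A X < dist² B X)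
fDir≡true-on-line A B X ABX≡0 with det A B X ≟ 0ℤ
... | yes _      = ⌊⌋≡true⇔ (dist² A X <? dist² B X)
... | no ABX≢0   = contradiction ABX≡0 ABX≢0

fDir≡true-off-line : ∀ A B X → det A B X ≢ 0ℤ → (fDir A B X ≡ true) ⇔ (0ℤ < det A B X)
fDir≡true-off-line A B X ABX≢0 with det A B X ≟ 0ℤ
... | yes ABX≡0 = contradiction ABX≡0 ABX≢0
... | no _      = ⌊⌋≡true⇔ (0ℤ <? det A B X)

det-repeat : ∀ P Q → det P Q P ≡ 0ℤ
det-repeat (p1 , p2) (q1 , q2) = +-inverseʳ ((p1 * q2 + p2 * p1) + q1 * p2)

+-cancelˡ-≤ : ∀ x {i j} → x + i ≤ x + j → i ≤ j
+-cancelˡ-≤ x {i} {j} x+i≤x+j = subst₂ _≤_ (cancel x i) (cancel x j) (+-monoʳ-≤ (- x) x+i≤x+j)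
  where
  cancel : ∀ x y → - x + (x + y) ≡ y
  cancel = solve-∀

0≤i+i⇒0≤i : ∀ i → 0ℤ ≤ i + i → 0ℤ ≤ i
0≤i+i⇒0≤i (+ n)    _ = +≤+ z≤n
0≤i+i⇒0≤i -[1+ n ] ()

i*i<suc[i]*suc[i]⇔0≤i : ∀ i → (i * i < suc i * suc i) ⇔ (0ℤ ≤ i)
i*i<suc[i]*suc[i]⇔0≤i i = begin
  i * i < suc i * suc i                ∼⟨ mk⇔ i<j⇒suc[i]≤j suc[i]≤j⇒i<j ⟩
  suc (i * i) ≤ suc i * suc i          ∼⟨ mk⇔ i≤j⇒0≤j-i 0≤i-j⇒j≤i ⟩
  0ℤ ≤ suc i * suc i - suc (i * i)     ≡⟨ cong (0ℤ ≤_) (difference i) ⟩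
  0ℤ ≤ i + i                           ∼⟨ mk⇔ (0≤i+i⇒0≤i i) (λ 0≤i → +-mono-≤ 0≤i 0≤i) ⟩
  0ℤ ≤ i                               ∎
  where
  open EquationalReasoning
  difference : ∀ i → (1ℤ + i) * (1ℤ + i) - (1ℤ + i * i) ≡ i + i
  difference = solve-∀

0≤i*i : ∀ i → 0ℤ ≤ i * i
0≤i*i (+ 0)      = +≤+ z≤n
0≤i*i +[1+ n ]   = +≤+ z≤n
0≤i*i -[1+ n ]   = +≤+ z≤n

0<i*i : ∀ {i} → i ≢ 0ℤ → 0ℤ < i * i
0<i*i {+ 0}      i≢0 = contradiction refl i≢0
0<i*i {+[1+ n ]}  _   = +<+ z<s
0<i*i { -[1+ n ]} _   = +<+ z<s

Between : ℤ → ℤ → ℤ → Set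
Between x y z = (x ≤ z × z ≤ y) ⊎ (y ≤ z × z ≤ x)

module _ {a b k : ℤ} where

  Between-sym : Between a b k → Between b a k
  Between-sym (inj₁ a≤k≤b) = inj₂ a≤k≤b
  Between-sym (inj₂ b≤k≤a) = inj₁ b≤k≤a

  Between⇔≤×≤ : a ≤ b → Between a b k ⇔ (a ≤ k × k ≤ b)
  Between⇔≤×≤ a≤b = mk⇔ to inj₁
    where
    to : Between a b k → a ≤ k × k ≤ b
    to (inj₁ a≤k≤b)       = a≤k≤b
    to (inj₂ (b≤k , k≤a)) = ≤-trans a≤b b≤k , ≤-trans k≤a a≤b

  Between⇔⊓≤×≤⊔ : Between a b k ⇔ (a ⊓ b ≤ k × k ≤ a ⊔ b)
  Between⇔⊓≤×≤⊔ = mk⇔ to from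
    where
    to : Between a b k → a ⊓ b ≤ k × k ≤ a ⊔ b
    to (inj₁ (a≤k , k≤b)) = ≤-trans (i⊓j≤i a b) a≤k , ≤-trans k≤b (i≤j⊔i a b)
    to (inj₂ (b≤k , k≤a)) = ≤-trans (i⊓j≤j a b) b≤k , ≤-trans k≤a (i≤i⊔j a b)
    from : a ⊓ b ≤ k × k ≤ a ⊔ b → Between a b k
    from (lo , hi) with ≤-total a b
    ... | inj₁ a≤b = inj₁ (subst (_≤ k) (i≤j⇒i⊓j≡i a≤b) lo , subst (k ≤_) (i≤j⇒i⊔j≡j a≤b) hi)
    ... | inj₂ b≤a = inj₂ (subst (_≤ k) (i≥j⇒i⊓j≡j b≤a) lo , subst (k ≤_) (i≥j⇒i⊔j≡i b≤a) hi)

Between-self : ∀ {a k} → Between a a k → k ≡ a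
Between-self (inj₁ (a≤k , k≤a)) = ≤-antisym k≤a a≤k
Between-self (inj₂ (a≤k , k≤a)) = ≤-antisym k≤a a≤k

module _ (f g : ℤ → ℤ) {a b k : ℤ} where

  Between-map : (∀ {i j} → f i ≤ f j → g i ≤ g j) →
                Between (f a) (f b) (f k) → Between (g a) (g b) (g k)
  Between-map mono (inj₁ (lo , hi)) = inj₁ (mono lo , mono hi)
  Between-map mono (inj₂ (lo , hi)) = inj₂ (mono lo , mono hi)

  Between-map-antitone : (∀ {i j} → f i ≤ f j → g j ≤ g i) →
                         Between (f a) (f b) (f k) → Between (g a) (g b) (g k)
  Between-map-antitone anti (inj₁ (lo , hi)) = inj₂ (anti hi , anti lo)
  Between-map-antitone anti (inj₂ (lo , hi)) = inj₁ (anti hi , anti lo)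

Between-+ˡ : ∀ x {a b k} → Between a b k → Between (x + a) (x + b) (x + k)
Between-+ˡ x = Between-map id (λ z → x + z) (+-monoʳ-≤ x)

Between-+ˡ⁻¹ : ∀ x {a b k} → Between (x + a) (x + b) (x + k) → Between a b k
Between-+ˡ⁻¹ x = Between-map (λ z → x + z) id (+-cancelˡ-≤ x)

Between-*ʳ : ∀ u {a b k} → Between a b k → Between (a * u) (b * u) (k * u)
Between-*ʳ u with ≤-total 0ℤ u
... | inj₁ 0≤u = Between-map id (_* u) (*-monoʳ-≤-nonNeg u {{nonNegative 0≤u}})
... | inj₂ u≤0 = Between-map-antitone id (_* u) (*-monoʳ-≤-nonPos u {{nonPositive u≤0}})

Between-*ʳ⁻¹ : ∀ {u a b k} → u ≢ 0ℤ → Between (a * u) (b * u) (k * u) → Between a b k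
Between-*ʳ⁻¹ {u} u≢0 with <-cmp u 0ℤ
... | tri< u<0 _ _ = Between-map-antitone (_* u) id (*-cancelʳ-≤-neg _ _ u {{negative u<0}})
... | tri≈ _ u≡0 _ = contradiction u≡0 u≢0
... | tri> _ _ 0<u = Between-map (_* u) id (*-cancelʳ-≤-pos _ _ u {{positive 0<u}})

Between-affine : ∀ x u {a b k} → Between a b k → Between (x + a * u) (x + b * u) (x + k * u)
Between-affine x u = Between-+ˡ x ∘ Between-*ʳ u

Between-affine⁻¹ : ∀ x {u a b k} → u ≢ 0ℤ → Between (x + a * u) (x + b * u) (x + k * u) → Between a b k
Between-affine⁻¹ x u≢0 = Between-*ʳ⁻¹ u≢0 ∘ Between-+ˡ⁻¹ x

Between-cong : ∀ {a a′ b b′ k k′} → a ≡ a′ → b ≡ b′ → k ≡ k′ → Between a b k → Between a′ b′ k′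
Between-cong refl refl refl h = h

Between-shift : ∀ {x y z} → Between 0ℤ (y - x) (z - x) → Between x y z
Between-shift {x} {y} {z} = Between-cong (+-identityʳ x) (identity x y) (identity x z) ∘ Between-+ˡ x
  where
  identity : ∀ x y → x + (y - x) ≡ y
  identity = solve-∀

Between-0-fraction : ∀ {n r v w} → n ≢ 0ℤ → Between 0ℤ n r → w * n ≡ r * v → Between 0ℤ v w
Between-0-fraction {n} {r} {v} {w} n≢0 0≤r≤n w*n≡r*v =
  Between-*ʳ⁻¹ {a = 0ℤ} n≢0 (Between-cong refl (*-comm n v) (sym w*n≡r*v) (Between-*ʳ v 0≤r≤n))

OnSegment-self : ∀ Q X → OnSegment Q Q X → X ≡ Q
OnSegment-self (q1 , q2) (x1 , x2) (_ , box1 , box2) =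
  cong₂ _,_ (Between-self (Equivalence.from (Between⇔⊓≤×≤⊔ {q1} {q1} {x1}) box1))
            (Between-self (Equivalence.from (Between⇔⊓≤×≤⊔ {q2} {q2} {x2}) box2))

module Line (a1 a2 b1 b2 : ℤ) where

  A B : Point
  A = a1 , a2
  B = b1 , b2

  u1 u2 N : ℤ
  u1 = b1 - a1
  u2 = b2 - a2
  N  = u1 * u1 + u2 * u2

  shift : ℤ → Point → Point
  shift k (x1 , x2) = x1 + k * u1 , x2 + k * u2

  P : ℤ → Point
  P k = shift k A

  dot : Point → ℤ
  dot (x1 , x2) = u1 * (x1 - a1) + u2 * (x2 - a2)

  A≡P0 : A ≡ P 0ℤ
  A≡P0 = cong₂ _,_ (sym (+-identityʳ a1)) (sym (+-identityʳ a2))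

  -- Stated with `suc 0ℤ` rather than `1ℤ`: the two are convertible, but checking that
  -- conversion under `fDir` unfolds integer multiplication and is prohibitively slow.
  B≡P[suc0] : B ≡ P (suc 0ℤ)
  B≡P[suc0] = cong₂ _,_ (identity a1 b1) (identity a2 b2)
    where
    identity : ∀ a b → b ≡ a + (1ℤ + 0ℤ) * (b - a)
    identity = solve-∀

  shift-shift-neg : ∀ k X → shift k (shift (- k) X) ≡ X
  shift-shift-neg k (x1 , x2) = cong₂ _,_ (identity x1 u1 k) (identity x2 u2 k)
    where
    identity : ∀ x u k → (x + - k * u) + k * u ≡ x
    identity = solve-∀

  det-shift : ∀ k X → det A B (shift k X) ≡ det A B X
  det-shift k (x1 , x2) = identity a1 a2 b1 b2 k x1 x2
    where
    -- The ring solver does not unfold `det`, so identities about it are stated on its polynomial.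
    identity : ∀ a1 a2 b1 b2 k x1 x2 →
      let det′ = λ x1 x2 → ((a1 * b2 + a2 * x1) + b1 * x2) - ((x1 * b2 + x2 * a1) + b1 * a2)
      in det′ (x1 + k * (b1 - a1)) (x2 + k * (b2 - a2)) ≡ det′ x1 x2
    identity = solve-∀

  det-A-B-P : ∀ k → det A B (P k) ≡ 0ℤ
  det-A-B-P k = trans (det-shift k A) (det-repeat A B)

  det-P-P : ∀ a b X → det (P a) (P b) X ≡ (b - a) * det A B X
  det-P-P a b (x1 , x2) = identity a1 a2 b1 b2 a b x1 x2
    where
    identity : ∀ a1 a2 b1 b2 a b x1 x2 →
      let det′ = λ p1 p2 q1 q2 → ((p1 * q2 + p2 * x1) + q1 * x2) - ((x1 * q2 + x2 * p1) + q1 * p2)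
          u1 = b1 - a1
          u2 = b2 - a2
      in det′ (a1 + a * u1) (a2 + a * u2) (a1 + b * u1) (a2 + b * u2) ≡ (b - a) * det′ a1 a2 b1 b2
    identity = solve-∀

  det-P-Ppred : ∀ c X → det (P c) (P (pred c)) X ≡ - det A B X
  det-P-Ppred c X = trans (det-P-P c (pred c) X) (identity c (det A B X))
    where
    identity : ∀ c δ → (-1ℤ + c - c) * δ ≡ - δ
    identity = solve-∀

  dist²-P-P : ∀ a k → dist² (P a) (P k) ≡ (a - k) * (a - k) * N
  dist²-P-P a k = identity a1 a2 b1 b2 a k
    where
    identity : ∀ a1 a2 b1 b2 a k →
      let u1 = b1 - a1
          u2 = b2 - a2
          sq = λ z → z * z
      in sq ((a1 + a * u1) - (a1 + k * u1)) + sq ((a2 + a * u2) - (a2 + k * u2))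
         ≡ sq (a - k) * (sq u1 + sq u2)
    identity = solve-∀

  dot-shift : ∀ k X → dot (shift k X) ≡ dot X + k * N
  dot-shift k (x1 , x2) = identity a1 a2 b1 b2 k x1 x2
    where
    identity : ∀ a1 a2 b1 b2 k x1 x2 →
      let u1 = b1 - a1
          u2 = b2 - a2
      in u1 * ((x1 + k * u1) - a1) + u2 * ((x2 + k * u2) - a2)
         ≡ (u1 * (x1 - a1) + u2 * (x2 - a2)) + k * (u1 * u1 + u2 * u2)
    identity = solve-∀

  det-P-P-P : ∀ a b k → det (P a) (P b) (P k) ≡ 0ℤ
  det-P-P-P a b k = trans (det-P-P a b (P k)) (trans (cong ((b - a) *_) (det-A-B-P k)) (*-zeroʳ (b - a)))

  Between⇒OnSegment-P : ∀ {a b k} → Between a b k → OnSegment (P a) (P b) (P k)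
  Between⇒OnSegment-P {a} {b} {k} a≤k≤b =
    det-P-P-P a b k ,
    Equivalence.to Between⇔⊓≤×≤⊔ (Between-affine a1 u1 a≤k≤b) ,
    Equivalence.to Between⇔⊓≤×≤⊔ (Between-affine a2 u2 a≤k≤b)

  OnSegment-A-P⇒collinear : ∀ c X → OnSegment A (P c) X → det A B X ≡ 0ℤ
  OnSegment-A-P⇒collinear c X A-Pc-X = [ c≡0⇒collinear , id ]′ (i*j≡0⇒i≡0∨j≡0 (c - 0ℤ) c*ABX≡0)
    where
    c*ABX≡0 : (c - 0ℤ) * det A B X ≡ 0ℤ
    c*ABX≡0 = trans (sym (det-P-P 0ℤ c X)) (subst (λ Z → det Z (P c) X ≡ 0ℤ) A≡P0 (proj₁ A-Pc-X))
    c≡0⇒collinear : c - 0ℤ ≡ 0ℤ → det A B X ≡ 0ℤ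
    c≡0⇒collinear c≡0 = subst (λ Z → det A B Z ≡ 0ℤ) (sym (OnSegment-self A X A-A-X)) (det-repeat A B)
      where
      A-A-X : OnSegment A A X
      A-A-X = subst (λ Z → OnSegment A Z X) (trans (cong P (i-j≡0⇒i≡j c 0ℤ c≡0)) (sym A≡P0)) A-Pc-X

  off-line-not-true : ∀ c X → det A B X ≢ 0ℤ → (fDir A B X ∧ fDir (P c) (P (pred c)) X) ≢ true
  off-line-not-true c X ABX≢0 both-true = <-asym 0<δ (neg-cancel-< {0ℤ} {δ} 0<-δ)
    where
    δ : ℤ
    δ = det A B X
    det[CX]≢0 : det (P c) (P (pred c)) X ≢ 0ℤ
    det[CX]≢0 det[CX]≡0 = ABX≢0 (neg-injective (trans (sym (det-P-Ppred c X)) det[CX]≡0))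
    0<δ : 0ℤ < δ
    0<δ = Equivalence.to (fDir≡true-off-line A B X ABX≢0) (proj₁ (Equivalence.to ∧≡true⇔ both-true))
    0<-δ : 0ℤ < - δ
    0<-δ = subst (0ℤ <_) (det-P-Ppred c X)
             (Equivalence.to (fDir≡true-off-line (P c) (P (pred c)) X det[CX]≢0)
                             (proj₂ (Equivalence.to ∧≡true⇔ both-true)))

  module _ (A≢B : A ≢ B) where

    u≢0 : u1 ≢ 0ℤ ⊎ u2 ≢ 0ℤ
    u≢0 with u1 ≟ 0ℤ | u2 ≟ 0ℤ
    ... | no u1≢0 | _         = inj₁ u1≢0
    ... | yes _   | no u2≢0   = inj₂ u2≢0
    ... | yes u1≡0 | yes u2≡0 =
      contradiction (cong₂ _,_ (sym (i-j≡0⇒i≡j b1 a1 u1≡0)) (sym (i-j≡0⇒i≡j b2 a2 u2≡0))) A≢B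

    0<N : 0ℤ < N
    0<N with u≢0
    ... | inj₁ u1≢0 = +-mono-<-≤ (0<i*i u1≢0) (0≤i*i u2)
    ... | inj₂ u2≢0 = +-mono-≤-< (0≤i*i u1) (0<i*i u2≢0)

    P-injective : ∀ {a b} → P a ≡ P b → a ≡ b
    P-injective {a} {b} Pa≡Pb with u≢0
    ... | inj₁ u1≢0 = *-cancelʳ-≡ a b u1 {{≢-nonZero u1≢0}} (+-cancelˡ-≡ a1 _ _ (cong proj₁ Pa≡Pb))
    ... | inj₂ u2≢0 = *-cancelʳ-≡ a b u2 {{≢-nonZero u2≢0}} (+-cancelˡ-≡ a2 _ _ (cong proj₂ Pa≡Pb))

    collinear-between⇒OnSegment-A-B : ∀ X → det A B X ≡ 0ℤ → Between 0ℤ N (dot X) → OnSegment A B X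
    collinear-between⇒OnSegment-A-B (x1 , x2) ABX≡0 0≤dot≤N =
      ABX≡0 ,
      Equivalence.to Between⇔⊓≤×≤⊔ (Between-shift (Between-0-fraction N≢0 0≤dot≤N projection₁)) ,
      Equivalence.to Between⇔⊓≤×≤⊔ (Between-shift (Between-0-fraction N≢0 0≤dot≤N projection₂))
      where
      X : Point
      X = x1 , x2
      N≢0 : N ≢ 0ℤ
      N≢0 N≡0 = <⇒≢ 0<N (sym N≡0)
      identity₁ : ∀ a1 a2 b1 b2 x1 x2 →
        let u1 = b1 - a1
            u2 = b2 - a2
            det′ = ((a1 * b2 + a2 * x1) + b1 * x2) - ((x1 * b2 + x2 * a1) + b1 * a2)
        in (x1 - a1) * (u1 * u1 + u2 * u2) ≡ (u1 * (x1 - a1) + u2 * (x2 - a2)) * u1 - det′ * u2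
      identity₁ = solve-∀
      identity₂ : ∀ a1 a2 b1 b2 x1 x2 →
        let u1 = b1 - a1
            u2 = b2 - a2
            det′ = ((a1 * b2 + a2 * x1) + b1 * x2) - ((x1 * b2 + x2 * a1) + b1 * a2)
        in (x2 - a2) * (u1 * u1 + u2 * u2) ≡ (u1 * (x1 - a1) + u2 * (x2 - a2)) * u2 + det′ * u1
      identity₂ = solve-∀
      projection₁ : (x1 - a1) * N ≡ dot X * u1
      projection₁ = begin
        (x1 - a1) * N                   ≡⟨ identity₁ a1 a2 b1 b2 x1 x2 ⟩
        dot X * u1 - det A B X * u2     ≡⟨ cong (λ δ → dot X * u1 - δ * u2) ABX≡0 ⟩
        dot X * u1 - 0ℤ * u2            ≡⟨ +-identityʳ (dot X * u1) ⟩
        dot X * u1                      ∎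
        where open ≡-Reasoning
      projection₂ : (x2 - a2) * N ≡ dot X * u2
      projection₂ = begin
        (x2 - a2) * N                   ≡⟨ identity₂ a1 a2 b1 b2 x1 x2 ⟩
        dot X * u2 + det A B X * u1     ≡⟨ cong (λ δ → dot X * u2 + δ * u1) ABX≡0 ⟩
        dot X * u2 + 0ℤ * u1            ≡⟨ +-identityʳ (dot X * u2) ⟩
        dot X * u2                      ∎
        where open ≡-Reasoning

    OnSegment-P⇔Between : ∀ a b k → OnSegment (P a) (P b) (P k) ⇔ Between a b k
    OnSegment-P⇔Between a b k = mk⇔ to Between⇒OnSegment-P
      where
      to : OnSegment (P a) (P b) (P k) → Between a b k
      to (_ , box1 , box2) with u≢0
      ... | inj₁ u1≢0 = Between-affine⁻¹ a1 u1≢0 (Equivalence.from Between⇔⊓≤×≤⊔ box1)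
      ... | inj₂ u2≢0 = Between-affine⁻¹ a2 u2≢0 (Equivalence.from Between⇔⊓≤×≤⊔ box2)

    fDir-P≡true⇔ : ∀ a b k → (fDir (P a) (P b) (P k) ≡ true) ⇔ ((a - k) * (a - k) < (b - k) * (b - k))
    fDir-P≡true⇔ a b k = begin
      fDir (P a) (P b) (P k) ≡ true                        ∼⟨ fDir≡true-on-line (P a) (P b) (P k) (det-P-P-P a b k) ⟩
      dist² (P a) (P k) < dist² (P b) (P k)                ≡⟨ cong₂ _<_ (dist²-P-P a k) (dist²-P-P b k) ⟩
      (a - k) * (a - k) * N < (b - k) * (b - k) * N        ∼⟨ mk⇔ (*-cancelʳ-<-nonNeg N {{nonNegative (<⇒≤ 0<N)}})
                                                                   (*-monoʳ-<-pos N {{positive 0<N}}) ⟩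
      (a - k) * (a - k) < (b - k) * (b - k)                ∎
      where
      open EquationalReasoning

    fDir-P-Psuc≡true⇔ : ∀ a k → (fDir (P a) (P (suc a)) (P k) ≡ true) ⇔ (k ≤ a)
    fDir-P-Psuc≡true⇔ a k = begin
      fDir (P a) (P (suc a)) (P k) ≡ true               ∼⟨ fDir-P≡true⇔ a (suc a) k ⟩
      (a - k) * (a - k) < (suc a - k) * (suc a - k)     ≡⟨ cong (λ z → (a - k) * (a - k) < z * z) (identity a k) ⟩
      (a - k) * (a - k) < suc (a - k) * suc (a - k)     ∼⟨ i*i<suc[i]*suc[i]⇔0≤i (a - k) ⟩
      0ℤ ≤ a - k                                        ∼⟨ mk⇔ 0≤i-j⇒j≤i i≤j⇒0≤j-i ⟩
      k ≤ a                                             ∎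
      where
      open EquationalReasoning
      identity : ∀ a k → (1ℤ + a) - k ≡ 1ℤ + (a - k)
      identity = solve-∀

    fDir-P-Ppred≡true⇔ : ∀ a k → (fDir (P a) (P (pred a)) (P k) ≡ true) ⇔ (a ≤ k)
    fDir-P-Ppred≡true⇔ a k = begin
      fDir (P a) (P (pred a)) (P k) ≡ true              ∼⟨ fDir-P≡true⇔ a (pred a) k ⟩
      (a - k) * (a - k) < (pred a - k) * (pred a - k)   ≡⟨ cong₂ _<_ (identity₁ a k) (identity₂ a k) ⟩
      (k - a) * (k - a) < suc (k - a) * suc (k - a)     ∼⟨ i*i<suc[i]*suc[i]⇔0≤i (k - a) ⟩
      0ℤ ≤ k - a                                        ∼⟨ mk⇔ 0≤i-j⇒j≤i i≤j⇒0≤j-i ⟩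
      a ≤ k                                             ∎
      where
      open EquationalReasoning
      identity₁ : ∀ a k → (a - k) * (a - k) ≡ (k - a) * (k - a)
      identity₁ = solve-∀
      identity₂ : ∀ a k → (-1ℤ + a - k) * (-1ℤ + a - k) ≡ (1ℤ + (k - a)) * (1ℤ + (k - a))
      identity₂ = solve-∀

    fDir-A-B≡true⇔ : ∀ k → (fDir A B (P k) ≡ true) ⇔ (k ≤ 0ℤ)
    fDir-A-B≡true⇔ k = subst₂ (λ U V → (fDir U V (P k) ≡ true) ⇔ (k ≤ 0ℤ)) (sym A≡P0) (sym B≡P[suc0])
                              (fDir-P-Psuc≡true⇔ 0ℤ k)

    fDir-P-Psuc-A≡true⇔ : ∀ c → (fDir (P c) (P (suc c)) A ≡ true) ⇔ (0ℤ ≤ c)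
    fDir-P-Psuc-A≡true⇔ c = subst (λ Z → (fDir (P c) (P (suc c)) Z ≡ true) ⇔ (0ℤ ≤ c)) (sym A≡P0)
                                  (fDir-P-Psuc≡true⇔ c 0ℤ)

    Adjacent-P⇒consecutive : ∀ c d → Adjacent (P c) (P d) → d ≡ suc c ⊎ d ≡ pred c
    Adjacent-P⇒consecutive c d (Pc≢Pd , only-ends) = by-order (<-cmp c d)
      where
      inner-point-is-d : ∀ k → Between c d k → k ≢ c → d ≡ k
      inner-point-is-d k c≤k≤d k≢c =
        [ (λ Pk≡Pc → contradiction (P-injective {k} {c} Pk≡Pc) k≢c)
        , (λ Pk≡Pd → sym (P-injective {k} {d} Pk≡Pd)) ]′
          (only-ends (P k) (Between⇒OnSegment-P c≤k≤d))

      by-order : Tri (c < d) (c ≡ d) (d < c) → d ≡ suc c ⊎ d ≡ pred c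
      by-order (tri≈ _ c≡d _) = contradiction (cong P c≡d) Pc≢Pd
      by-order (tri< c<d _ _) =
        inj₁ (inner-point-is-d (suc c) (inj₁ (i≤suc[i] c , i<j⇒suc[i]≤j c<d)) (i≢suc[i] ∘ sym))
      by-order (tri> _ _ d<c) =
        inj₂ (inner-point-is-d (pred c) (inj₂ (i<j⇒i≤pred[j] d<c , i≤j⇒pred[i]≤j ≤-refl))
                               (λ pred[c]≡c → i≢suc[i] (trans pred[c]≡c (sym (suc-pred c)))))

    proper-collinear-pair-shape : ∀ c d → Adjacent (P c) (P d) → fDir (P c) (P d) A ≡ true →
                            fDir A B (P c) ≡ true → fDir A B (P d) ≡ true → c ≤ 0ℤ × d ≡ pred c
    proper-collinear-pair-shape c d CD-adjacent fCD[A] fAB[C] fAB[D] =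
      Equivalence.to (fDir-A-B≡true⇔ c) fAB[C] ,
      [ (λ d≡suc[c] → contradiction d≡suc[c] d≢suc[c]) , id ]′ (Adjacent-P⇒consecutive c d CD-adjacent)
      where
      d≢suc[c] : d ≢ suc c
      d≢suc[c] d≡suc[c] = <⇒≱ c<0 0≤c
        where
        c<0 : c < 0ℤ
        c<0 = suc[i]≤j⇒i<j (subst (_≤ 0ℤ) d≡suc[c] (Equivalence.to (fDir-A-B≡true⇔ d) fAB[D]))
        0≤c : 0ℤ ≤ c
        0≤c = Equivalence.to (fDir-P-Psuc-A≡true⇔ c) (subst (λ z → fDir (P c) (P z) A ≡ true) d≡suc[c] fCD[A])

    true-points-on-line : ∀ c → c ≤ 0ℤ → ∀ k →
      ((fDir A B (P k) ∧ fDir (P c) (P (pred c)) (P k)) ≡ true) ⇔ OnSegment A (P c) (P k)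
    true-points-on-line c c≤0 k = begin
      (fDir A B (P k) ∧ fDir (P c) (P (pred c)) (P k)) ≡ true          ∼⟨ ∧≡true⇔ ⟩
      (fDir A B (P k) ≡ true × fDir (P c) (P (pred c)) (P k) ≡ true)   ∼⟨ fDir-A-B≡true⇔ k ×-⇔ fDir-P-Ppred≡true⇔ c k ⟩
      (k ≤ 0ℤ × c ≤ k)                                                  ∼⟨ mk⇔ swap swap ⟩
      (c ≤ k × k ≤ 0ℤ)                                                  ∼⟨ ⇔-sym (Between⇔≤×≤ c≤0) ⟩
      Between c 0ℤ k                                                    ∼⟨ mk⇔ Between-sym Between-sym ⟩
      Between 0ℤ c k                                                    ∼⟨ ⇔-sym (OnSegment-P⇔Between 0ℤ c k) ⟩
      OnSegment (P 0ℤ) (P c) (P k)                                      ≡⟨ cong (λ Z → OnSegment Z (P c) (P k)) (sym A≡P0) ⟩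
      OnSegment A (P c) (P k)                                           ∎
      where
      open EquationalReasoning

  module _ (AB-adjacent : Adjacent A B) where

    private
      A≢B : A ≢ B
      A≢B = proj₁ AB-adjacent

    -- Reducing dot X modulo N gives a translate Y = X - q u with 0 ≤ dot Y < N; such a point
    -- lies on the segment AB, and as AB is prime, Y = A.
    collinear⇒P : ∀ X → det A B X ≡ 0ℤ → ∃[ k ] X ≡ P k
    collinear⇒P X ABX≡0 = q , X≡P[q]
      where
      instance
        N-nonZero : NonZero N
        N-nonZero = >-nonZero (0<N A≢B)
      q r : ℤ
      q = dot X / N
      r = + (dot X % N)
      Y : Point
      Y = shift (- q) X
      dot[Y]≡r : dot Y ≡ r
      dot[Y]≡r = begin
        dot Y                  ≡⟨ dot-shift (- q) X ⟩
        dot X + - q * N        ≡⟨ cong (λ t → t + - q * N) (a≡a%n+[a/n]*n (dot X) N) ⟩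
        r + q * N + - q * N    ≡⟨ identity r q N ⟩
        r                      ∎
        where
        open ≡-Reasoning
        identity : ∀ r q n → r + q * n + - q * n ≡ r
        identity = solve-∀
      r<N : r < N
      r<N = subst (r <_) (0≤i⇒+∣i∣≡i (<⇒≤ (0<N A≢B))) (+<+ (n%d<d (dot X) N))
      Y∈AB : OnSegment A B Y
      Y∈AB = collinear-between⇒OnSegment-A-B A≢B Y (trans (det-shift (- q) X) ABX≡0)
               (inj₁ (subst (0ℤ ≤_) (sym dot[Y]≡r) (+≤+ z≤n) , subst (_≤ N) (sym dot[Y]≡r) (<⇒≤ r<N)))
      Y≡A : Y ≡ A
      Y≡A = [ id , (λ Y≡B → contradiction (trans (sym dot[Y]≡r) (cong dot Y≡B)) (<⇒≢ r<N)) ]′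
              (proj₂ AB-adjacent Y Y∈AB)
      X≡P[q] : X ≡ P q
      X≡P[q] = trans (sym (shift-shift-neg q X)) (cong (shift q) Y≡A)

    true-points : ∀ c → c ≤ 0ℤ → ∀ X →
      ((fDir A B X ∧ fDir (P c) (P (pred c)) X) ≡ true) ⇔ OnSegment A (P c) X
    true-points c c≤0 X = by-collinearity (det A B X ≟ 0ℤ)
      where
      by-collinearity : Dec (det A B X ≡ 0ℤ) →
                        ((fDir A B X ∧ fDir (P c) (P (pred c)) X) ≡ true) ⇔ OnSegment A (P c) X
      by-collinearity (yes ABX≡0) =
        subst (λ Z → ((fDir A B Z ∧ fDir (P c) (P (pred c)) Z) ≡ true) ⇔ OnSegment A (P c) Z)
              (sym (proj₂ (collinear⇒P X ABX≡0)))
              (true-points-on-line A≢B c c≤0 (proj₁ (collinear⇒P X ABX≡0)))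
      by-collinearity (no ABX≢0) =
        mk⇔ (λ both-true → contradiction both-true (off-line-not-true c X ABX≢0))
            (λ A-Pc-X → contradiction (OnSegment-A-P⇒collinear c X A-Pc-X) ABX≢0)

    true-points-of-pair : ∀ {C D} c d → C ≡ P c → D ≡ P d → Adjacent C D → fDir C D A ≡ true →
      fDir A B C ≡ true → fDir A B D ≡ true →
      ∀ X → ((fDir A B X ∧ fDir C D X) ≡ true) ⇔ OnSegment A C X
    true-points-of-pair c d refl refl CD-adjacent fCD[A] fAB[C] fAB[D] X =
      subst (λ z → ((fDir A B X ∧ fDir (P c) (P z) X) ≡ true) ⇔ OnSegment A (P c) X) (sym d≡pred[c])
            (true-points c c≤0 X)
      where
      c≤0×d≡pred[c] : c ≤ 0ℤ × d ≡ pred c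
      c≤0×d≡pred[c] = proper-collinear-pair-shape A≢B c d CD-adjacent fCD[A] fAB[C] fAB[D]
      c≤0 : c ≤ 0ℤ
      c≤0 = proj₁ c≤0×d≡pred[c]
      d≡pred[c] : d ≡ pred c
      d≡pred[c] = proj₂ c≤0×d≡pred[c]

    true-points-of-proper-collinear-pair : ∀ C D → Adjacent C D → fDir C D A ≡ true →
      fDir A B C ≡ true → fDir A B D ≡ true → det A B C ≡ 0ℤ → det A B D ≡ 0ℤ →
      ∀ X → ((fDir A B X ∧ fDir C D X) ≡ true) ⇔ OnSegment A C X
    true-points-of-proper-collinear-pair C D CD-adjacent fCD[A] fAB[C] fAB[D] C∈ℓ D∈ℓ =
      true-points-of-pair c d C≡P[c] D≡P[d] CD-adjacent fCD[A] fAB[C] fAB[D]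
      where
      c d : ℤ
      c = proj₁ (collinear⇒P C C∈ℓ)
      d = proj₁ (collinear⇒P D D∈ℓ)
      C≡P[c] : C ≡ P c
      C≡P[c] = proj₂ (collinear⇒P C C∈ℓ)
      D≡P[d] : D ≡ P d
      D≡P[d] = proj₂ (collinear⇒P D D∈ℓ)

corollary3 : (m n : ℕ) (A B C D : Point) (f : Point → Bool)
    → Proper m n A B C D → CollinearSegs A B C D → Defines m n A B C D f
    → ∀ (X : Point) → InGrid m n X → ((f X ≡ true) ⇔ OnSegment A C X)
corollary3 m n (a1 , a2) (b1 , b2) C D f (_ , (AB-adjacent , CD-adjacent) , (fCD[A] , _) , (fAB[C] , fAB[D]))
           (C∈ℓ , D∈ℓ) defines X X∈G =
  subst (λ b → (b ≡ true) ⇔ OnSegment (a1 , a2) C X) (sym (defines X X∈G))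
        (Line.true-points-of-proper-collinear-pair a1 a2 b1 b2 AB-adjacent
           C D CD-adjacent fCD[A] fAB[C] fAB[D] C∈ℓ D∈ℓ X)
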